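{- Let $\Gamma$ be a telescopic numerical semigroup minimally generated by $r_0<r_1<\cdots<r_h$. If $h\ge 2$, then $r_h\ge 2^{h+1}-1$.
   Context: A numerical semigroup is a submonoid $\Gamma$ of $(\mathbb N,+)$ with finite complement in $\mathbb N$. $\langle X\rangle$ denotes the submonoid of $\mathbb N$ generated by $X$. For a numerical semigroup with minimal generators listed in a fixed order $(r_0,\ldots,r_h)$, set $d_k=\gcd(r_0,\ldots,r_{k-1})$ for $k=1,\ldots,h+1$ and $\Gamma_k=\langle r_0/d_{k+1},\ldots,r_k/d_{k+1}\rangle$. Gluing: if $A$ is the minimal generating set of a numerical semigroup and $A=A_1\cup A_2$ is a nontrivial partition with $a_i=\gcd(A_i)$, then $A$ is the gluing of $A_1$ and $A_2$ if $\mathrm{lcm}(a_1,a_2)\in\langle A_1\rangle\cap\langle A_2\rangle$. $\Gamma$ is free for the arrangement $(r_0,\ldots,r_h)$ if either $h=0$ (so $r_0=1$) or $\{r_0,\ldots,r_h\}$ is the gluing of $\{r_0,\ldots,r_{h-1}\}$ and $\{r_h\}$ and $\Gamma_{h-1}$ is free for the arrangement $(r_0/d_h,\ldots,r_{h-1}/d_h)$. $\Gamma$ is telescopic if it is free for the arrangement of its minimal generators in increasing order $r_0<\cdots<r_h$. -}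

module Defs where

open import Data.Nat using (ℕ; zero; suc; _+_; _*_; _≤_; _<_)
open import Data.Nat.GCD using (gcd)
open import Data.Nat.LCM using (lcm)
open import Data.List using (List; []; _∷_; _++_; length; foldr; removeAt; lookup)
open import Data.Vec as V using (Vec; init; last; toList)
open import Data.Fin using (Fin; inject₁) renaming (suc to fsuc)
open import Data.Product using (Σ; ∃; _×_; _,_)
open import Relation.Binary.PropositionalEquality using (_≡_)
open import Relation.Nullary using (¬_)

data _∈⟨_⟩ : ℕ → List ℕ → Set where
  nil  : 0 ∈⟨ [] ⟩
  cons : ∀ {n m a as} (c : ℕ) → m ∈⟨ as ⟩ → n ≡ c * a + m → n ∈⟨ a ∷ as ⟩

gcdList : List ℕ → ℕ
gcdList = foldr gcd 0

IsNumericalSemigroup : List ℕ → Set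
IsNumericalSemigroup A = Σ ℕ λ N → ∀ n → N ≤ n → n ∈⟨ A ⟩

-- A is a minimal generating set of the monoid it generates:
-- no element lies in the monoid generated by the remaining ones
-- (this also forces the elements to be nonzero and pairwise distinct).
IsMinimalGens : List ℕ → Set
IsMinimalGens A = ∀ (i : Fin (length A)) → ¬ (lookup A i ∈⟨ removeAt A i ⟩)

IsMinGensOfNumSgp : List ℕ → Set
IsMinGensOfNumSgp A = IsNumericalSemigroup A × IsMinimalGens A

-- A₁ ∪ A₂ (listed as A₁ ++ A₂) is the gluing of A₁ and A₂
-- (A₁, A₂ nonempty; disjointness follows from minimality)
data NonEmpty : List ℕ → Set where
  nonEmpty : ∀ {a as} → NonEmpty (a ∷ as)

IsGluing : List ℕ → List ℕ → Set
IsGluing A₁ A₂ =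
  IsMinGensOfNumSgp (A₁ ++ A₂) × NonEmpty A₁ × NonEmpty A₂ ×
  (lcm (gcdList A₁) (gcdList A₂) ∈⟨ A₁ ⟩) × (lcm (gcdList A₁) (gcdList A₂) ∈⟨ A₂ ⟩)

-- In the recursive step, rs' = (r₀/d_h, …, r_{h-1}/d_h) where d_h = gcd(r₀,…,r_{h-1}),
-- described without division as the vector with d_h * rs' = (r₀,…,r_{h-1}).
IsFree : (h : ℕ) → Vec ℕ (suc h) → Set
IsFree zero    rs = V.head rs ≡ 1
IsFree (suc h) rs =
  IsGluing (toList (init rs)) (last rs ∷ []) ×
  Σ (Vec ℕ (suc h)) λ rs' →
    (V.map (gcdList (toList (init rs)) *_) rs' ≡ init rs) × IsFree h rs'

StrictlyIncreasing : ∀ {h} → Vec ℕ (suc h) → Set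
StrictlyIncreasing {h} rs = ∀ (i : Fin h) → V.lookup rs (inject₁ i) < V.lookup rs (fsuc i)

IsTelescopic : (h : ℕ) → Vec ℕ (suc h) → Set
IsTelescopic h rs = IsFree h rs

-- Write d for the gcd of r₀,…,r_{h-1}. Since {r_h} is glued to the
-- remaining generators, lcm(d, r_h) lies in ⟨r₀,…,r_{h-1}⟩; if d were 1 this
-- would put r_h there, against minimality, so d ≥ 2. Hence
-- r_h + 1 ≥ r_{h-1} + 2 = d·(r_{h-1}/d) + 2 ≥ 2·(r_{h-1}/d + 1), and the
-- bound r_h + 1 ≥ 2^(h+1) follows by induction on the arrangement
-- (r₀/d,…,r_{h-1}/d), which is again free and increasing, down to r₀ = 1.
module Submission where

open import Defs
open import Data.Nat using (ℕ; zero; suc; _+_; _*_; _^_; _∸_; _≤_; _<_; z≤n; s≤s)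
open import Data.Nat.Properties
open import Data.Nat.GCD using (gcd; gcd-zeroˡ; gcd-identityʳ; gcd[m,n]≡0⇒m≡0)
open import Data.Nat.LCM using (lcm; gcd*lcm)
open import Data.List using (List; []; _∷_; _++_; length; removeAt)
  renaming (lookup to lookupL)
open import Data.Vec using (Vec; _∷_; []; init; last; map; lookup; toList)
open import Data.Vec.Properties using (lookup-map)
open import Data.Fin using (Fin; inject₁) renaming (suc to fsuc; zero to fzero)
open import Data.Product using (Σ; _×_; _,_)
open import Relation.Binary.PropositionalEquality
open import Relation.Nullary using (¬_; contradiction)

lcm[1,n]≡n : ∀ n → lcm 1 n ≡ n
lcm[1,n]≡n n = begin
  lcm 1 n            ≡⟨ sym (*-identityˡ _) ⟩
  1 * lcm 1 n        ≡⟨ cong (_* lcm 1 n) (sym (gcd-zeroˡ n)) ⟩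
  gcd 1 n * lcm 1 n  ≡⟨ gcd*lcm 1 n ⟩
  1 * n              ≡⟨ *-identityˡ n ⟩
  n                  ∎
  where open ≡-Reasoning

0∈⟨⟩ : ∀ A → 0 ∈⟨ A ⟩
0∈⟨⟩ []      = nil
0∈⟨⟩ (a ∷ A) = cons 0 (0∈⟨⟩ A) refl

minimalGens⇒head≢0 : ∀ {a A} → IsMinimalGens (a ∷ A) → a ≢ 0
minimalGens⇒head≢0 {A = A} mg refl = mg fzero (0∈⟨⟩ A)

lastIndex : ∀ (A : List ℕ) x → Σ (Fin (length (A ++ x ∷ []))) λ i →
  lookupL (A ++ x ∷ []) i ≡ x × removeAt (A ++ x ∷ []) i ≡ A
lastIndex []      x = fzero , refl , refl
lastIndex (a ∷ A) x with lastIndex A x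
... | i , lookup≡x , remove≡A = fsuc i , lookup≡x , cong (a ∷_) remove≡A

minimalGens⇒last∉⟨init⟩ : ∀ (A : List ℕ) {x} → IsMinimalGens (A ++ x ∷ []) → ¬ (x ∈⟨ A ⟩)
minimalGens⇒last∉⟨init⟩ A {x} mg x∈⟨A⟩ with lastIndex A x
... | i , lookup≡x , remove≡A = mg i (subst₂ _∈⟨_⟩ (sym lookup≡x) (sym remove≡A) x∈⟨A⟩)

gluing-singleton⇒2≤gcd : ∀ {A x} → IsGluing A (x ∷ []) → 2 ≤ gcdList A
gluing-singleton⇒2≤gcd {a ∷ A} {x} ((_ , mg) , nonEmpty , _ , lcm∈⟨A⟩ , _)
  with gcdList (a ∷ A) in gcd≡
... | 0           = contradiction (gcd[m,n]≡0⇒m≡0 gcd≡) (minimalGens⇒head≢0 mg)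
... | 1           = contradiction x∈⟨A⟩ (minimalGens⇒last∉⟨init⟩ (a ∷ A) mg)
  where
  x∈⟨A⟩ : x ∈⟨ a ∷ A ⟩
  x∈⟨A⟩ = subst (_∈⟨ a ∷ A ⟩) (trans (lcm[1,n]≡n _) (gcd-identityʳ x)) lcm∈⟨A⟩
... | suc (suc _) = s≤s (s≤s z≤n)

last-map : ∀ {n} (f : ℕ → ℕ) (v : Vec ℕ (suc n)) → last (map f v) ≡ f (last v)
last-map f (x ∷ [])     = refl
last-map f (x ∷ y ∷ xs) = last-map f (y ∷ xs)

lookup-init : ∀ {n} (v : Vec ℕ (suc (suc n))) (i : Fin (suc n)) →
  lookup (init v) i ≡ lookup v (inject₁ i)
lookup-init (x ∷ y ∷ [])     fzero    = refl
lookup-init (x ∷ y ∷ z ∷ xs) fzero    = refl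
lookup-init (x ∷ y ∷ z ∷ xs) (fsuc i) = lookup-init (y ∷ z ∷ xs) i

strictlyIncreasing-init : ∀ {n} (v : Vec ℕ (suc (suc n))) →
  StrictlyIncreasing v → StrictlyIncreasing (init v)
strictlyIncreasing-init v inc i =
  subst₂ _<_ (sym (lookup-init v (inject₁ i))) (sym (lookup-init v (fsuc i))) (inc (inject₁ i))

strictlyIncreasing-*-cancelˡ : ∀ {n} d (v : Vec ℕ (suc n)) →
  StrictlyIncreasing (map (d *_) v) → StrictlyIncreasing v
strictlyIncreasing-*-cancelˡ d v inc i =
  *-cancelˡ-< d _ _ (subst₂ _<_ (lookup-map (inject₁ i) (d *_) v) (lookup-map (fsuc i) (d *_) v) (inc i))

last-init<last : ∀ {n} (v : Vec ℕ (suc (suc n))) → StrictlyIncreasing v → last (init v) < last v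
last-init<last (x ∷ y ∷ [])     inc = inc fzero
last-init<last (x ∷ y ∷ z ∷ xs) inc = last-init<last (y ∷ z ∷ xs) (λ i → inc (fsuc i))

free⇒2^[1+h]≤1+last : ∀ h (rs : Vec ℕ (suc h)) →
  StrictlyIncreasing rs → IsFree h rs → 2 ^ suc h ≤ suc (last rs)
free⇒2^[1+h]≤1+last zero    (r ∷ []) _   refl = ≤-refl
free⇒2^[1+h]≤1+last (suc h) rs       inc (glued , rs' , d*rs'≡init , free') = begin
  2 * 2 ^ suc h             ≤⟨ *-monoʳ-≤ 2 ih ⟩
  2 * suc (last rs')        ≡⟨ *-suc 2 (last rs') ⟩
  2 + 2 * last rs'          ≤⟨ +-monoʳ-≤ 2 (*-monoˡ-≤ (last rs') (gluing-singleton⇒2≤gcd glued)) ⟩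
  2 + d * last rs'          ≡⟨ cong (2 +_) (sym last-init≡d*last) ⟩
  2 + last (init rs)        ≤⟨ s≤s (last-init<last rs inc) ⟩
  suc (last rs)             ∎
  where
  open ≤-Reasoning
  d = gcdList (toList (init rs))
  last-init≡d*last : last (init rs) ≡ d * last rs'
  last-init≡d*last = trans (cong last (sym d*rs'≡init)) (last-map (d *_) rs')
  inc' : StrictlyIncreasing rs'
  inc' = strictlyIncreasing-*-cancelˡ d rs'
    (subst StrictlyIncreasing (sym d*rs'≡init) (strictlyIncreasing-init rs inc))
  ih : 2 ^ suc h ≤ suc (last rs')
  ih = free⇒2^[1+h]≤1+last h rs' inc' free'

proposition4p1 : (h : ℕ) (rs : Vec ℕ (suc h)) →
    StrictlyIncreasing rs →
    IsMinGensOfNumSgp (toList rs) →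
    IsTelescopic h rs →
    2 ≤ h →
    2 ^ (suc h) ∸ 1 ≤ last rs
proposition4p1 h rs inc _ telescopic _ =
  m≤n+o⇒m∸n≤o (2 ^ suc h) 1 (free⇒2^[1+h]≤1+last h rs inc telescopic)
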